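{- For every positive integer $n$ and every permutation $\pi\in S_3$, we have $L_n(\pi)=n$.
   Context: An $n$-th order Latin Square is an $n\times n$ grid filled with the symbols $1,2,\dots,n$ such that each symbol appears exactly once in each row and exactly once in each column. Reading each row from left to right gives a permutation of $\{1,\dots,n\}$ (a row permutation), and reading each column from top to bottom gives a permutation (a column permutation). A permutation $\sigma$ of length $n$ contains a pattern $\pi\in S_k$ ($k\le n$) if some subsequence of $\sigma$ of length $k$ is order isomorphic to $\pi$ (its entries appear in the same relative order as the entries of $\pi$); otherwise $\sigma$ avoids $\pi$. A Latin Square avoids $\pi$ if all of its row permutations and all of its column permutations avoid $\pi$. $L_n(\pi)$ denotes the number of $n$-th order Latin Squares avoiding $\pi$. -}

module Defs where

open import Data.Nat using (ℕ)
open import Data.Fin using (Fin; _<_)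
open import Data.Fin.Permutation using (Permutation′; _⟨$⟩ʳ_)
open import Data.Vec using (Vec; lookup)
open import Data.Product using (Σ; ∃; ∃!; _×_)
open import Data.List using (List; length)
open import Data.List.Relation.Unary.All using (All)
open import Data.List.Relation.Unary.Unique.Propositional using (Unique)
open import Data.List.Membership.Propositional using (_∈_)
open import Function.Bundles using (_⇔_)
open import Relation.Nullary using (¬_)
open import Relation.Binary.PropositionalEquality using (_≡_)

-- A sequence of length n with values in Fin n (symbols 1..n are encoded as 0..n-1).
-- An n×n grid: Square n = vector of n rows, each a vector of n symbols.
Square : ℕ → Set
Square n = Vec (Vec (Fin n) n) n

entry : ∀ {n} → Square n → Fin n → Fin n → Fin n
entry M i j = lookup (lookup M i) j

row : ∀ {n} → Square n → Fin n → (Fin n → Fin n)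
row M i j = entry M i j

col : ∀ {n} → Square n → Fin n → (Fin n → Fin n)
col M j i = entry M i j

IsLatin : ∀ {n} → Square n → Set
IsLatin {n} M =
  (∀ (i s : Fin n) → ∃! _≡_ (λ j → entry M i j ≡ s)) ×
  (∀ (j s : Fin n) → ∃! _≡_ (λ i → entry M i j ≡ s))

Contains : ∀ {n k} → (Fin n → Fin n) → Permutation′ k → Set
Contains {n} {k} σ π =
  Σ (Fin k → Fin n) λ f →
    (∀ (a b : Fin k) → a < b → f a < f b) ×
    (∀ (a b : Fin k) → (σ (f a) < σ (f b)) ⇔ ((π ⟨$⟩ʳ a) < (π ⟨$⟩ʳ b)))

Avoids : ∀ {n k} → (Fin n → Fin n) → Permutation′ k → Set
Avoids σ π = ¬ Contains σ π

SquareAvoids : ∀ {n k} → Square n → Permutation′ k → Set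
SquareAvoids {n} M π = (∀ (i : Fin n) → Avoids (row M i) π) × (∀ (j : Fin n) → Avoids (col M j) π)

HasCard : ∀ {A : Set} → (A → Set) → ℕ → Set
HasCard {A} P c =
  Σ (List A) λ xs → Unique xs × All P xs × (∀ x → P x → x ∈ xs) × (length xs ≡ c)

LCount : ℕ → ∀ {k} → Permutation′ k → ℕ → Set
LCount n π c = HasCard (λ (M : Square n) → IsLatin M × SquareAvoids M π) c

module Submission where

-- The six patterns fall into two classes by shape (positions of the smallest,
-- middle and largest letter): 132, 213, 321 are avoided exactly by the n cyclic
-- squares c + i + j (mod n), and 123, 231, 312 exactly by their complements.
-- Squares are studied through their tables f i j on numbers below n = m + 1.
-- The heart is a row lemma (RowIsRotation): a row with no 132 starting at its
-- first entry v, meeting none of the rotations that start below v, is the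
-- rotation starting at v; induction on first entries (rows-by-first-entry) makes
-- every row of a 132-avoiding Latin square a rotation.  Reflecting positions
-- 1, …, m handles 123, reversing all positions handles 231, and complementing
-- values the other three (descending-rows, ascending-rows).  Rows and columns
-- that all ascend cyclically pin the square down from its corner
-- (ascending-square).  Finally the squares of Defs are translated to tables, and
-- the count is read off the injective parametrisation by the corner
-- (card-of-family).

open import Defs

open import Data.Nat using (ℕ; zero; suc; _+_; _∸_; _≤_; _<_; z≤n; s≤s; s≤s⁻¹; _≤?_; _<?_)
open import Data.Nat.Properties
open import Data.Nat.DivMod using (_%_; _mod_; m<n⇒m%n≡m; m%n<n; n%n≡0; %-distribˡ-+; m%n%n≡m%n; [m+n]%n≡m%n)
open import Data.Nat.Induction using (<-rec)
open import Data.Product using (Σ; ∃; ∃!; _×_; _,_; proj₁; proj₂)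
open import Data.Sum using (_⊎_; inj₁; inj₂)
open import Data.Empty using (⊥; ⊥-elim)
open import Relation.Nullary using (¬_; yes; no; contradiction)
open import Relation.Binary.PropositionalEquality
open import Relation.Binary using (tri<; tri≈; tri>)
open import Data.Fin using (Fin; toℕ; opposite)
import Data.Fin as F
open import Data.Fin.Patterns using (0F; 1F; 2F)
open import Data.Fin.Properties using (opposite-involutive; opposite-prop; toℕ-injective; toℕ<n; toℕ-fromℕ<)
import Data.Fin.Properties as FinP
open import Data.Fin.Permutation using (Permutation′; _⟨$⟩ʳ_; _⟨$⟩ˡ_; inverseˡ; inverseʳ)
open import Data.Vec using (tabulate; lookup)
open import Data.Vec.Properties using (lookup∘tabulate; tabulate∘lookup; tabulate-cong)
import Data.List as List
open import Data.List.Properties using (length-tabulate)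
open import Data.List.Membership.Propositional using (_∈_)
open import Data.List.Membership.Propositional.Properties using (∈-tabulate⁺)
import Data.List.Relation.Unary.All.Properties as All
import Data.List.Relation.Unary.Unique.Propositional.Properties as Unique
open import Function.Bundles using (Equivalence; mk⇔)

∸-<-+ : ∀ {a b c} → a < b + c → b ≤ a → a ∸ b < c
∸-<-+ {a} {b} {c} lt le = subst (a ∸ b <_) (m+n∸m≡n b c) (∸-monoˡ-< lt le)

deflation-is-id : ∀ {v} (τ : ℕ → ℕ) → (∀ {a b} → a < v → b < v → τ a ≡ τ b → a ≡ b)
                → (∀ {a} → a < v → τ a ≤ a) → ∀ {a} → a < v → τ a ≡ a
deflation-is-id {v} τ inj shrinks {a} = <-rec (λ a → a < v → τ a ≡ a) step a
  where
    step : ∀ a → (∀ {b} → b < a → b < v → τ b ≡ b) → a < v → τ a ≡ a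
    step a ih a<v with m≤n⇒m<n∨m≡n (shrinks a<v)
    ... | inj₂ τa≡a = τa≡a
    ... | inj₁ τa<a = ⊥-elim (<-irrefl (inj τa<v a<v (ih τa<a τa<v)) τa<a)
      where τa<v = <-trans τa<a a<v

increasing-gap : (ρ : ℕ → ℕ) {K : ℕ} → (∀ {k} → k < K → ρ k < ρ (suc k))
               → ∀ k d → k + d ≤ K → ρ k + d ≤ ρ (k + d)
increasing-gap ρ step k zero _ = ≤-reflexive (trans (+-identityʳ (ρ k)) (cong ρ (sym (+-identityʳ k))))
increasing-gap ρ step k (suc d) k+d<K = begin
  ρ k + suc d     ≡⟨ +-suc (ρ k) d ⟩
  suc (ρ k + d)   ≤⟨ s≤s (increasing-gap ρ step k d (≤-trans (+-monoʳ-≤ k (n≤1+n d)) k+d<K)) ⟩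
  suc (ρ (k + d)) ≤⟨ step (≤-trans (≤-reflexive (sym (+-suc k d))) k+d<K) ⟩
  ρ (suc (k + d)) ≡⟨ cong ρ (sym (+-suc k d)) ⟩
  ρ (k + suc d)   ∎
  where open ≤-Reasoning

card-of-family : ∀ {A : Set} {P : A → Set} {k} (F : Fin k → A) → (∀ {c d} → F c ≡ F d → c ≡ d)
               → (∀ c → P (F c)) → (∀ x → P x → ∃ λ c → x ≡ F c) → HasCard P k
card-of-family F injective good complete =
  List.tabulate F , Unique.tabulate⁺ injective , All.tabulate⁺ good ,
  (λ x px → let (c , x≡Fc) = complete x px in subst (_∈ List.tabulate F) (sym x≡Fc) (∈-tabulate⁺ c)) ,
  length-tabulate F

-- A pattern of length 3 recorded by the positions (among 0F, 1F, 2F) of its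
-- smallest, middle and largest letter; e.g. 132 has shape (0F , 2F , 1F).
Shape : Set
Shape = Fin 3 × Fin 3 × Fin 3

-- the shapes of 132, 213 and 321, which cyclic rotations avoid
data Ascending : Shape → Set where
  asc132 : Ascending (0F , 2F , 1F)
  asc213 : Ascending (1F , 0F , 2F)
  asc321 : Ascending (2F , 1F , 0F)

-- the shapes of 123, 231 and 312, which complements of cyclic rotations avoid
data Descending : Shape → Set where
  desc123 : Descending (0F , 1F , 2F)
  desc231 : Descending (2F , 0F , 1F)
  desc312 : Descending (1F , 2F , 0F)

-- complementing a pattern exchanges its smallest and largest letters
mirror : ∀ {a b c} → Descending (a , b , c) → Ascending (c , b , a)
mirror desc123 = asc321
mirror desc231 = asc213
mirror desc312 = asc132

shape : Permutation′ 3 → Shape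
shape π = π ⟨$⟩ˡ 0F , π ⟨$⟩ˡ 1F , π ⟨$⟩ˡ 2F

classify : (g : Fin 3 → Fin 3) → (∀ {a b} → g a ≡ g b → a ≡ b)
         → Ascending (g 0F , g 1F , g 2F) ⊎ Descending (g 0F , g 1F , g 2F)
classify g injective with g 0F in e0 | g 1F in e1 | g 2F in e2
... | 0F | 2F | 1F = inj₁ asc132
... | 1F | 0F | 2F = inj₁ asc213
... | 2F | 1F | 0F = inj₁ asc321
... | 0F | 1F | 2F = inj₂ desc123
... | 2F | 0F | 1F = inj₂ desc231
... | 1F | 2F | 0F = inj₂ desc312
... | 0F | 0F | _  = contradiction (injective (trans e0 (sym e1))) λ ()
... | 1F | 1F | _  = contradiction (injective (trans e0 (sym e1))) λ ()
... | 2F | 2F | _  = contradiction (injective (trans e0 (sym e1))) λ ()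
... | 0F | _  | 0F = contradiction (injective (trans e0 (sym e2))) λ ()
... | 1F | _  | 1F = contradiction (injective (trans e0 (sym e2))) λ ()
... | 2F | _  | 2F = contradiction (injective (trans e0 (sym e2))) λ ()
... | _  | 0F | 0F = contradiction (injective (trans e1 (sym e2))) λ ()
... | _  | 1F | 1F = contradiction (injective (trans e1 (sym e2))) λ ()
... | _  | 2F | 2F = contradiction (injective (trans e1 (sym e2))) λ ()

inverse-injective : (π : Permutation′ 3) → ∀ {a b} → π ⟨$⟩ˡ a ≡ π ⟨$⟩ˡ b → a ≡ b
inverse-injective π {a} {b} eq = trans (sym (inverseʳ π)) (trans (cong (π ⟨$⟩ʳ_) eq) (inverseʳ π))

increasing₃ : (q : Fin 3 → ℕ) → q 0F < q 1F → q 1F < q 2F → ∀ {a b} → a F.< b → q a < q b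
increasing₃ q q01 q12 {0F} {1F} _ = q01
increasing₃ q q01 q12 {0F} {2F} _ = <-trans q01 q12
increasing₃ q q01 q12 {1F} {2F} _ = q12
increasing₃ q q01 q12 {0F} {0F} ()
increasing₃ q q01 q12 {1F} {0F} ()
increasing₃ q q01 q12 {1F} {1F} (s≤s ())
increasing₃ q q01 q12 {2F} {0F} ()
increasing₃ q q01 q12 {2F} {1F} (s≤s ())
increasing₃ q q01 q12 {2F} {2F} (s≤s (s≤s ()))

module Order (m : ℕ) where

  n : ℕ
  n = suc m

  %-small : ∀ {a} → a < n → a % n ≡ a
  %-small = m<n⇒m%n≡m

  %-absorbˡ : ∀ a b → (a % n + b) % n ≡ (a + b) % n
  %-absorbˡ a b = begin
    (a % n + b) % n            ≡⟨ %-distribˡ-+ (a % n) b n ⟩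
    (a % n % n + b % n) % n    ≡⟨ cong (λ x → (x + b % n) % n) (m%n%n≡m%n a n) ⟩
    (a % n + b % n) % n        ≡⟨ %-distribˡ-+ a b n ⟨
    (a + b) % n                ∎
    where open ≡-Reasoning

  %-absorbʳ : ∀ a b → (a + b % n) % n ≡ (a + b) % n
  %-absorbʳ a b = begin
    (a + b % n) % n ≡⟨ cong (_% n) (+-comm a (b % n)) ⟩
    (b % n + a) % n ≡⟨ %-absorbˡ b a ⟩
    (b + a) % n     ≡⟨ cong (_% n) (+-comm b a) ⟩
    (a + b) % n     ∎
    where open ≡-Reasoning

  rot : ℕ → ℕ → ℕ
  rot k j = (k + j) % n

  rot<n : ∀ k j → rot k j < n
  rot<n k j = m%n<n (k + j) n

  m∸<n : ∀ j → m ∸ j < n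
  m∸<n j = s≤s (m∸n≤m m j)

  -- σ is a bijection of [0, n) onto itself (values outside [0, n) are irrelevant)
  record IsBij (σ : ℕ → ℕ) : Set where
    field
      bounded    : ∀ {j} → j < n → σ j < n
      injective  : ∀ {j k} → j < n → k < n → σ j ≡ σ k → j ≡ k
      surjective : ∀ {s} → s < n → ∃ λ j → j < n × σ j ≡ s

  -- the inverse of a bijection of [0, n), extended by 0
  module Inverse {σ : ℕ → ℕ} (bij : IsBij σ) where
    open IsBij bij

    pos : ℕ → ℕ
    pos s with s <? n
    ... | yes s<n = proj₁ (surjective s<n)
    ... | no _    = 0

    pos<n : ∀ {s} → s < n → pos s < n
    pos<n {s} s<n with s <? n
    ... | yes p = proj₁ (proj₂ (surjective p))
    ... | no ¬p = ⊥-elim (¬p s<n)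

    σ∘pos : ∀ {s} → s < n → σ (pos s) ≡ s
    σ∘pos {s} s<n with s <? n
    ... | yes p = proj₂ (proj₂ (surjective p))
    ... | no ¬p = ⊥-elim (¬p s<n)

    pos∘σ : ∀ {j} → j < n → pos (σ j) ≡ j
    pos∘σ j<n = injective (pos<n (bounded j<n)) j<n (σ∘pos (bounded j<n))

  Anchored132 : (ℕ → ℕ) → Set
  Anchored132 σ = ∀ {y z} → y < z → z < n → σ 0 < σ z → σ z < σ y → ⊥

  -- A bijection σ of [0, n) with no 132 anchored at σ 0 = v, and
  -- which meets none of the rotations rot u (u < v), is the rotation rot v.
  -- Writing K = m ∸ v: the values v, v + 1, …, m appear in increasing order, and
  -- avoiding the smaller rotations forces them into positions 0, …, K; the small
  -- values 0, …, v - 1 are then forced into positions K + 1, …, m in order.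
  module RowIsRotation {σ : ℕ → ℕ} (bij : IsBij σ) (anchored : Anchored132 σ)
      (misses : ∀ {u j} → u < σ 0 → j < n → σ j ≡ rot u j → ⊥) where
    open IsBij bij
    open Inverse bij

    v K : ℕ
    v = σ 0
    K = m ∸ v

    v≤m : v ≤ m
    v≤m = s≤s⁻¹ (bounded (s≤s z≤n))

    n≡1+K+v : n ≡ suc K + v
    n≡1+K+v = cong suc (sym (m∸n+n≡m v≤m))

    above-diagonal : ∀ {j} → j < n → j ≤ σ j → j + v ≤ σ j
    above-diagonal {j} j<n j≤σj = ≮⇒≥ λ σj<j+v →
      misses (∸-<-+ σj<j+v j≤σj) j<n
        (sym (trans (cong (_% n) (m∸n+n≡m j≤σj)) (%-small (bounded j<n))))

    wrapped : ∀ {j} → j < n → σ j < j → j + v ≤ σ j + n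
    wrapped {j} j<n σj<j = ≮⇒≥ λ lt →
      misses (∸-<-+ lt j≤σj+n) j<n
        (sym (trans (cong (_% n) (m∸n+n≡m j≤σj+n))
                    (trans ([m+n]%n≡m%n (σ j) n) (%-small (bounded j<n)))))
      where j≤σj+n = ≤-trans (<⇒≤ j<n) (m≤n+m n (σ j))

    increasing : ∀ {p q} → p < n → q < n → v < σ p → σ p < σ q → p < q
    increasing {p} {q} p<n q<n v<σp σp<σq with <-cmp p q
    ... | tri< p<q _ _ = p<q
    ... | tri≈ _ refl _ = ⊥-elim (<-irrefl refl σp<σq)
    ... | tri> _ _ q<p = ⊥-elim (anchored q<p p<n v<σp σp<σq)

    ρ : ℕ → ℕ
    ρ k = pos (v + k)

    v+k<n : ∀ {k} → k ≤ K → v + k < n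
    v+k<n {k} k≤K = s≤s (≤-trans (+-monoʳ-≤ v k≤K) (≤-reflexive (m+[n∸m]≡n v≤m)))

    σ∘ρ : ∀ {k} → k ≤ K → σ (ρ k) ≡ v + k
    σ∘ρ k≤K = σ∘pos (v+k<n k≤K)

    ρ<n : ∀ {k} → k ≤ K → ρ k < n
    ρ<n k≤K = pos<n (v+k<n k≤K)

    ρ0≡0 : ρ 0 ≡ 0
    ρ0≡0 = trans (cong pos (+-identityʳ v)) (pos∘σ (s≤s z≤n))

    ρ-step : ∀ {k} → k < K → ρ k < ρ (suc k)
    ρ-step {zero} 0<K = subst (_< ρ 1) (sym ρ0≡0) (n≢0⇒n>0 λ ρ1≡0 →
      <-irrefl (trans (cong σ (sym ρ1≡0)) (σ∘ρ 0<K)) (m<m+n v (s≤s z≤n)))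
    ρ-step {suc k} k<K = increasing (ρ<n (<⇒≤ k<K)) (ρ<n k<K)
      (subst (v <_) (sym (σ∘ρ (<⇒≤ k<K))) (m<m+n v (s≤s z≤n)))
      (subst₂ _<_ (sym (σ∘ρ (<⇒≤ k<K))) (sym (σ∘ρ k<K)) (+-monoʳ-< v ≤-refl))

    ρK≤K : ρ K ≤ K
    ρK≤K = +-cancelʳ-≤ v (ρ K) K (begin
      ρ K + v     ≤⟨ above-diagonal (ρ<n ≤-refl) (subst (ρ K ≤_) (sym σρK≡m) (s≤s⁻¹ (ρ<n ≤-refl))) ⟩
      σ (ρ K)     ≡⟨ σρK≡m ⟩
      m           ≡⟨ m∸n+n≡m v≤m ⟨
      K + v       ∎)
      where
        open ≤-Reasoning
        σρK≡m : σ (ρ K) ≡ m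
        σρK≡m = trans (σ∘ρ ≤-refl) (m+[n∸m]≡n v≤m)

    ρ≡id : ∀ {k} → k ≤ K → ρ k ≡ k
    ρ≡id {k} k≤K = ≤-antisym upper lower
      where
        lower : k ≤ ρ k
        lower = subst (λ x → x + k ≤ ρ k) ρ0≡0 (increasing-gap ρ ρ-step 0 k k≤K)
        upper : ρ k ≤ k
        upper = +-cancelʳ-≤ (K ∸ k) (ρ k) k (begin
          ρ k + (K ∸ k)   ≤⟨ increasing-gap ρ ρ-step k (K ∸ k) (≤-reflexive (m+[n∸m]≡n k≤K)) ⟩
          ρ (k + (K ∸ k)) ≡⟨ cong ρ (m+[n∸m]≡n k≤K) ⟩
          ρ K             ≤⟨ ρK≤K ⟩
          K               ≡⟨ m+[n∸m]≡n k≤K ⟨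
          k + (K ∸ k)     ∎)
          where open ≤-Reasoning

    large : ∀ {j} → j ≤ K → σ j ≡ v + j
    large j≤K = subst (λ p → σ p ≡ v + _) (ρ≡id j≤K) (σ∘ρ j≤K)

    small : ∀ {j} → K < j → j < n → σ j < v
    small {j} K<j j<n = ≰⇒> λ v≤σj → <⇒≱ K<j (subst (_≤ K) (k≡j v≤σj) (k≤K v≤σj))
      where
        k≤K : v ≤ σ j → σ j ∸ v ≤ K
        k≤K _ = ∸-monoˡ-≤ v (s≤s⁻¹ (bounded j<n))
        k≡j : v ≤ σ j → σ j ∸ v ≡ j
        k≡j v≤σj = injective (≤-<-trans (k≤K v≤σj) (s≤s (m∸n≤m m v))) j<n
                     (trans (large (k≤K v≤σj)) (m+[n∸m]≡n v≤σj))

    pos-small : ∀ {u} → u < v → K < pos u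
    pos-small {u} u<v = ≰⇒> λ pu≤K →
      <⇒≱ u<v (≤-trans (m≤m+n v (pos u)) (≤-reflexive (trans (sym (large pu≤K)) (σ∘pos u<n))))
      where u<n = <-trans u<v (s≤s v≤m)

    pos-bound : ∀ {u} → u < v → pos u ≤ u + suc K
    pos-bound {u} u<v = +-cancelʳ-≤ v (pos u) (u + suc K) (begin
      pos u + v       ≤⟨ wrapped p<n σp<p ⟩
      σ (pos u) + n   ≡⟨ cong₂ _+_ (σ∘pos u<n) n≡1+K+v ⟩
      u + (suc K + v) ≡⟨ +-assoc u (suc K) v ⟨
      u + suc K + v   ∎)
      where
        open ≤-Reasoning
        u<n = <-trans u<v (s≤s v≤m)
        p<n = pos<n u<n
        σp<p : σ (pos u) < pos u
        σp<p = ≰⇒> λ p≤σp → <⇒≱ (subst (_< v) (sym (σ∘pos u<n)) u<v)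
                 (≤-trans (m≤n+m v (pos u)) (above-diagonal p<n p≤σp))

    pos-offset : ∀ {u} → u < v → pos u ≡ u + suc K
    pos-offset {u} u<v = begin
      pos u                   ≡⟨ m∸n+n≡m (pos-small u<v) ⟨
      (pos u ∸ suc K) + suc K ≡⟨ cong (_+ suc K) (deflation-is-id τ τ-injective τ-shrinks u<v) ⟩
      u + suc K               ∎
      where
        open ≡-Reasoning
        τ : ℕ → ℕ
        τ u = pos u ∸ suc K
        τ-shrinks : ∀ {u} → u < v → τ u ≤ u
        τ-shrinks {u} u<v = m≤n+o⇒m∸n≤o (pos u) (suc K) (subst (pos u ≤_) (+-comm u (suc K)) (pos-bound u<v))
        τ-injective : ∀ {a b} → a < v → b < v → τ a ≡ τ b → a ≡ b
        τ-injective {a} {b} a<v b<v eq = begin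
          a               ≡⟨ σ∘pos (<-trans a<v (s≤s v≤m)) ⟨
          σ (pos a)       ≡⟨ cong σ (∸-cancelʳ-≡ (pos-small a<v) (pos-small b<v) eq) ⟩
          σ (pos b)       ≡⟨ σ∘pos (<-trans b<v (s≤s v≤m)) ⟩
          b               ∎

    rotation : ∀ {j} → j < n → σ j ≡ rot v j
    rotation {j} j<n with j ≤? K
    ... | yes j≤K = trans (large j≤K) (sym (%-small (v+k<n j≤K)))
    ... | no j≰K = sym (begin
      (v + j) % n                 ≡⟨ cong (λ p → (v + p) % n) j≡σj+1+K ⟩
      (v + (σ j + suc K)) % n     ≡⟨ cong (_% n) (v+[s+1+K]≡s+n) ⟩
      (σ j + n) % n               ≡⟨ [m+n]%n≡m%n (σ j) n ⟩
      σ j % n                     ≡⟨ %-small (bounded j<n) ⟩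
      σ j                         ∎)
      where
        open ≡-Reasoning
        K<j = ≰⇒> j≰K
        j≡σj+1+K : j ≡ σ j + suc K
        j≡σj+1+K = trans (sym (pos∘σ j<n)) (pos-offset (small K<j j<n))
        v+[s+1+K]≡s+n : v + (σ j + suc K) ≡ σ j + n
        v+[s+1+K]≡s+n = trans (+-comm v _) (trans (+-assoc (σ j) (suc K) v) (cong (σ j +_) (sym n≡1+K+v)))

  bij-from-inverse : ∀ {σ τ} → (∀ {j} → j < n → σ j < n) → (∀ {j} → j < n → τ j < n)
                   → (∀ {j} → j < n → τ (σ j) ≡ j) → (∀ {j} → j < n → σ (τ j) ≡ j) → IsBij σ
  bij-from-inverse {σ} {τ} σ<n τ<n τσ στ = record
    { bounded    = σ<n
    ; injective  = λ j<n k<n eq → trans (sym (τσ j<n)) (trans (cong τ eq) (τσ k<n))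
    ; surjective = λ s<n → τ _ , τ<n s<n , στ s<n
    }

  ∘-bij : ∀ {σ τ} → IsBij σ → IsBij τ → IsBij (λ j → σ (τ j))
  ∘-bij {σ} {τ} bσ bτ = record
    { bounded    = λ j<n → Bσ.bounded (Bτ.bounded j<n)
    ; injective  = λ j<n k<n eq → Bτ.injective j<n k<n (Bσ.injective (Bτ.bounded j<n) (Bτ.bounded k<n) eq)
    ; surjective = λ s<n → let (t , t<n , σt≡s) = Bσ.surjective s<n
                               (j , j<n , τj≡t) = Bτ.surjective t<n
                           in j , j<n , trans (cong σ τj≡t) σt≡s
    }
    where module Bσ = IsBij bσ
          module Bτ = IsBij bτ

  bij-cong : ∀ {σ τ} → IsBij σ → (∀ {j} → j < n → σ j ≡ τ j) → IsBij τ
  bij-cong bσ eq = record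
    { bounded    = λ j<n → subst (_< n) (eq j<n) (bounded j<n)
    ; injective  = λ j<n k<n e → injective j<n k<n (trans (eq j<n) (trans e (sym (eq k<n))))
    ; surjective = λ s<n → let (j , j<n , e) = surjective s<n in j , j<n , trans (sym (eq j<n)) e
    }
    where open IsBij bσ

  m∸-bij : IsBij (m ∸_)
  m∸-bij = bij-from-inverse {m ∸_} {m ∸_} (λ {j} _ → m∸<n j) (λ {j} _ → m∸<n j) involutive involutive
    where involutive : ∀ {j} → j < n → m ∸ (m ∸ j) ≡ j
          involutive j<n = m∸[m∸n]≡n (s≤s⁻¹ j<n)

  rot-cancel : ∀ {a k j} → a + k ≡ n → j < n → rot a (rot k j) ≡ j
  rot-cancel {a} {k} {j} a+k≡n j<n = begin
    (a + (k + j) % n) % n ≡⟨ %-absorbʳ a (k + j) ⟩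
    (a + (k + j)) % n     ≡⟨ cong (_% n) (trans (sym (+-assoc a k j)) (cong (_+ j) a+k≡n)) ⟩
    (n + j) % n           ≡⟨ cong (_% n) (+-comm n j) ⟩
    (j + n) % n           ≡⟨ [m+n]%n≡m%n j n ⟩
    j % n                 ≡⟨ %-small j<n ⟩
    j                     ∎
    where open ≡-Reasoning

  rot-bij : ∀ {k} → k < n → IsBij (rot k)
  rot-bij {k} k<n = bij-from-inverse {rot k} {rot (n ∸ k)} (λ {j} _ → rot<n k j) (λ {j} _ → rot<n (n ∸ k) j)
    (rot-cancel {n ∸ k} {k} (m∸n+n≡m (<⇒≤ k<n))) (rot-cancel {k} {n ∸ k} (m+[n∸m]≡n (<⇒≤ k<n)))

  record Latin (f : ℕ → ℕ → ℕ) : Set where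
    field
      row-bij : ∀ {i} → i < n → IsBij (f i)
      col-bij : ∀ {j} → j < n → IsBij (λ i → f i j)

  transpose-latin : ∀ {f} → Latin f → Latin (λ i j → f j i)
  transpose-latin L = record { row-bij = Latin.col-bij L ; col-bij = Latin.row-bij L }

  map-latin : ∀ {φ f} → IsBij φ → Latin f → Latin (λ i j → φ (f i j))
  map-latin bφ L = record { row-bij = λ i<n → ∘-bij bφ (Latin.row-bij L i<n) ; col-bij = λ j<n → ∘-bij bφ (Latin.col-bij L j<n) }

  permute-columns : ∀ {ρ f} → IsBij ρ → Latin f → Latin (λ i j → f i (ρ j))
  permute-columns bρ L = record
    { row-bij = λ i<n → ∘-bij (Latin.row-bij L i<n) bρ
    ; col-bij = λ j<n → Latin.col-bij L (IsBij.bounded bρ j<n)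
    }

  latin-cong : ∀ {f g} → Latin f → (∀ {i j} → i < n → j < n → f i j ≡ g i j) → Latin g
  latin-cong L eq = record
    { row-bij = λ i<n → bij-cong (Latin.row-bij L i<n) (eq i<n)
    ; col-bij = λ j<n → bij-cong (Latin.col-bij L j<n) (λ i<n → eq i<n j<n)
    }

  -- Rows of a Latin square are determined one after another by their first
  -- entries: if a row that meets none of the canonical rows g u of smaller first
  -- entries u must be the canonical row of its own first entry, then every row
  -- is canonical.  (Induction on the first entry; column injectivity shows that a
  -- row meeting g u would be the row starting with u.)
  rows-by-first-entry : ∀ {f} (g : ℕ → ℕ → ℕ) → Latin f
    → (∀ {i} → i < n → (∀ {u j} → u < f i 0 → j < n → f i j ≡ g u j → ⊥) → ∀ {j} → j < n → f i j ≡ g (f i 0) j)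
    → ∀ {i} → i < n → ∀ {j} → j < n → f i j ≡ g (f i 0) j
  rows-by-first-entry {f} g L forced {i} i<n = <-rec P step (f i 0) i<n refl
    where
      column₀ = Latin.col-bij L (s≤s z≤n)
      P : ℕ → Set
      P v = ∀ {i} → i < n → f i 0 ≡ v → ∀ {j} → j < n → f i j ≡ g (f i 0) j
      step : ∀ v → (∀ {u} → u < v → P u) → P v
      step v ih {i} i<n refl = forced i<n misses
        where
          misses : ∀ {u j} → u < f i 0 → j < n → f i j ≡ g u j → ⊥
          misses {u} {j} u<v j<n fij≡guj
            with IsBij.surjective column₀ (<-trans u<v (IsBij.bounded column₀ i<n))
          ... | i′ , i′<n , fi′0≡u = <-irrefl (trans (sym fi′0≡u) (cong (λ k → f k 0) (sym i≡i′))) u<v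
            where
              fi′j≡guj : f i′ j ≡ g u j
              fi′j≡guj = trans (ih u<v i′<n fi′0≡u j<n) (cong (λ w → g w j) fi′0≡u)
              i≡i′ : i ≡ i′
              i≡i′ = IsBij.injective (Latin.col-bij L j<n) i<n i′<n (trans fij≡guj (sym fi′j≡guj))

  rotation-rows : ∀ {f} → Latin f → (∀ {i} → i < n → Anchored132 (f i))
                → ∀ {i} → i < n → ∀ {j} → j < n → f i j ≡ rot (f i 0) j
  rotation-rows L anchored = rows-by-first-entry rot L
    (λ i<n misses → RowIsRotation.rotation (Latin.row-bij L i<n) (anchored i<n) misses)

  reflect : ℕ → ℕ
  reflect zero    = zero
  reflect (suc j) = m ∸ j

  m∸-pred : ∀ {j} → suc j ≤ m → m ∸ j ≡ suc (m ∸ suc j)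
  m∸-pred j<m = +-∸-assoc 1 j<m

  reflect-involutive : ∀ {j} → j < n → reflect (reflect j) ≡ j
  reflect-involutive {zero}  _          = refl
  reflect-involutive {suc j} (s≤s j<m) = trans (cong reflect (m∸-pred j<m)) (m∸[m∸n]≡n j<m)

  reflect<n : ∀ j → reflect j < n
  reflect<n zero    = s≤s z≤n
  reflect<n (suc j) = m∸<n j

  reflect-bij : IsBij reflect
  reflect-bij = bij-from-inverse {reflect} {reflect} (λ {j} _ → reflect<n j) (λ {j} _ → reflect<n j)
                  reflect-involutive reflect-involutive

  Anchored123 : (ℕ → ℕ) → Set
  Anchored123 σ = ∀ {y z} → y < z → z < n → σ 0 < σ y → σ y < σ z → ⊥

  reflect-anchored : ∀ {σ} → Anchored123 σ → Anchored132 (λ j → σ (reflect j))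
  reflect-anchored {σ} anchored {zero}  {z}     _         _   σ0<σrz σrz<σ0 = <-asym σ0<σrz σrz<σ0
  reflect-anchored {σ} anchored {suc y} {suc z} (s≤s y<z) z<n σ0<σrz σrz<σry =
    anchored (∸-monoʳ-< y<z (<⇒≤ (s≤s⁻¹ z<n))) (m∸<n y) σ0<σrz σrz<σry

  reflected-rotation-rows : ∀ {f} → Latin f → (∀ {i} → i < n → Anchored123 (f i))
    → ∀ {i} → i < n → ∀ {j} → j < n → f i j ≡ rot (f i 0) (reflect j)
  reflected-rotation-rows {f} L anchored i<n {j} j<n = begin
    f _ j                   ≡⟨ cong (f _) (reflect-involutive j<n) ⟨
    f _ (reflect (reflect j)) ≡⟨ rotation-rows (permute-columns reflect-bij L)
                                   (λ i<n → reflect-anchored (anchored i<n)) i<n (reflect<n j) ⟩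
    rot (f _ 0) (reflect j) ∎
    where open ≡-Reasoning

  Up : (ℕ → ℕ) → Set
  Up σ = ∀ {j} → suc j < n → σ (suc j) ≡ suc (σ j) % n

  Down : (ℕ → ℕ) → Set
  Down σ = ∀ {j} → suc j < n → σ j ≡ suc (σ (suc j)) % n

  suc-% : ∀ x → suc (x % n) % n ≡ suc x % n
  suc-% = %-absorbʳ 1

  rot-suc : ∀ v j → rot v (suc j) ≡ suc (rot v j) % n
  rot-suc v j = trans (cong (_% n) (+-suc v j)) (sym (suc-% (v + j)))

  rotation⇒up : ∀ {σ v} → (∀ {j} → j < n → σ j ≡ rot v j) → Up σ
  rotation⇒up {σ} {v} rotation {j} j+1<n =
    trans (rotation j+1<n) (trans (rot-suc v j) (cong (λ x → suc x % n) (sym (rotation (<-trans (n<1+n j) j+1<n)))))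

  up⇒rotation : ∀ {σ} → σ 0 < n → Up σ → ∀ {j} → j < n → σ j ≡ rot (σ 0) j
  up⇒rotation {σ} σ0<n up {zero}  _      = sym (trans (cong (_% n) (+-identityʳ (σ 0))) (%-small σ0<n))
  up⇒rotation {σ} σ0<n up {suc j} j+1<n =
    trans (up j+1<n) (trans (cong (λ x → suc x % n) (up⇒rotation σ0<n up (<-trans (n<1+n j) j+1<n)))
                            (sym (rot-suc (σ 0) j)))

  up-cong : ∀ {σ τ} → (∀ {j} → j < n → σ j ≡ τ j) → Up σ → Up τ
  up-cong {σ} {τ} eq up {j} j+1<n =
    trans (sym (eq j+1<n)) (trans (up j+1<n) (cong (λ x → suc x % n) (eq (<-trans (n<1+n j) j+1<n))))

  reflected-rotation⇒down : ∀ {σ v} → (∀ {j} → j < n → σ j ≡ rot v (reflect j)) → Down σ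
  reflected-rotation⇒down {σ} {v} rotation {j} j+1<n = begin
    σ j                            ≡⟨ rotation (<-trans (n<1+n j) j+1<n) ⟩
    rot v (reflect j)              ≡⟨ predecessor j j+1<n ⟩
    rot v (suc (m ∸ j))            ≡⟨ rot-suc v (m ∸ j) ⟩
    suc (rot v (m ∸ j)) % n        ≡⟨ cong (λ x → suc x % n) (rotation j+1<n) ⟨
    suc (σ (suc j)) % n            ∎
    where
      open ≡-Reasoning
      predecessor : ∀ j → suc j < n → rot v (reflect j) ≡ rot v (suc (m ∸ j))
      predecessor zero    _             = trans (cong (_% n) (+-identityʳ v)) (sym ([m+n]%n≡m%n v n))
      predecessor (suc j) (s≤s j+2≤m)   = cong (rot v) (m∸-pred (<⇒≤ j+2≤m))

  complement-successor : ∀ {a b} → a < n → suc a % n ≡ b → suc (m ∸ b) % n ≡ m ∸ a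
  complement-successor {a} {b} a<n a+1≡b with m≤n⇒m<n∨m≡n (s≤s⁻¹ a<n)
  ... | inj₁ a<m = begin
    suc (m ∸ b) % n     ≡⟨ cong (λ x → suc (m ∸ x) % n) (trans (sym a+1≡b) (%-small (s≤s a<m))) ⟩
    suc (m ∸ suc a) % n ≡⟨ cong (_% n) (m∸-pred a<m) ⟨
    (m ∸ a) % n         ≡⟨ %-small (m∸<n a) ⟩
    m ∸ a               ∎
    where open ≡-Reasoning
  ... | inj₂ refl = begin
    suc (m ∸ b) % n     ≡⟨ cong (λ x → suc (m ∸ x) % n) (trans (sym a+1≡b) (n%n≡0 n)) ⟩
    n % n               ≡⟨ n%n≡0 n ⟩
    0                   ≡⟨ n∸n≡0 m ⟨
    m ∸ m               ∎
    where open ≡-Reasoning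

  down⇒complement-up : ∀ {σ} → (∀ {j} → j < n → σ j < n) → Down σ → Up (λ j → m ∸ σ j)
  down⇒complement-up bounded down j+1<n = sym (complement-successor (bounded j+1<n) (sym (down j+1<n)))

  reversed-up⇒down : ∀ {σ} → Up (λ j → σ (m ∸ j)) → Down σ
  reversed-up⇒down {σ} up {j} j+1<n =
    subst₂ (λ a b → σ a ≡ suc (σ b) % n) m∸[k+1]≡j m∸k≡j+1 (up k+1<n)
    where
      j+1≤m = s≤s⁻¹ j+1<n
      k = m ∸ suc j
      k+1≡m∸j : suc k ≡ m ∸ j
      k+1≡m∸j = sym (m∸-pred j+1≤m)
      k+1<n : suc k < n
      k+1<n = subst (_< n) (sym k+1≡m∸j) (m∸<n j)
      m∸[k+1]≡j : m ∸ suc k ≡ j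
      m∸[k+1]≡j = trans (cong (m ∸_) k+1≡m∸j) (m∸[m∸n]≡n (<⇒≤ j+1≤m))
      m∸k≡j+1 : m ∸ k ≡ suc j
      m∸k≡j+1 = m∸[m∸n]≡n j+1≤m

  Occurs : Shape → (ℕ → ℕ) → Set
  Occurs (a , b , c) τ =
    Σ (Fin 3 → ℕ) λ p → p 0F < p 1F × p 1F < p 2F × p 2F < n × τ (p a) < τ (p b) × τ (p b) < τ (p c)

  positions : ℕ → ℕ → ℕ → Fin 3 → ℕ
  positions x y z 0F = x
  positions x y z 1F = y
  positions x y z 2F = z

  occurs-complement : ∀ {a b c τ} → Occurs (a , b , c) (λ j → m ∸ τ j) → Occurs (c , b , a) τ
  occurs-complement (p , p0<p1 , p1<p2 , p2<n , lt₁ , lt₂) =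
    p , p0<p1 , p1<p2 , p2<n , ∸-cancelʳ-< lt₂ , ∸-cancelʳ-< lt₁

  occurs-reverse : ∀ {a b c τ} → Occurs (a , b , c) (λ j → τ (m ∸ j)) → Occurs (opposite a , opposite b , opposite c) τ
  occurs-reverse {a} {b} {c} {τ} (p , p0<p1 , p1<p2 , p2<n , lt₁ , lt₂) =
    q , ∸-monoʳ-< p1<p2 (s≤s⁻¹ p2<n) , ∸-monoʳ-< p0<p1 (s≤s⁻¹ (<-trans p1<p2 p2<n)) , m∸<n (p 0F) ,
    subst₂ _<_ (value a) (value b) lt₁ , subst₂ _<_ (value b) (value c) lt₂
    where
      q : Fin 3 → ℕ
      q k = m ∸ p (opposite k)
      value : ∀ k → τ (m ∸ p k) ≡ τ (q (opposite k))
      value k = cong (λ l → τ (m ∸ p l)) (sym (opposite-involutive k))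

  occurs-cong : ∀ {a b c σ τ} → (∀ {j} → j < n → σ j ≡ τ j) → Occurs (a , b , c) σ → Occurs (a , b , c) τ
  occurs-cong {a} {b} {c} eq (p , p0<p1 , p1<p2 , p2<n , lt₁ , lt₂) =
    p , p0<p1 , p1<p2 , p2<n , subst₂ _<_ (eq (p<n a)) (eq (p<n b)) lt₁ , subst₂ _<_ (eq (p<n b)) (eq (p<n c)) lt₂
    where
      p<n : ∀ k → p k < n
      p<n 0F = <-trans p0<p1 (<-trans p1<p2 p2<n)
      p<n 1F = <-trans p1<p2 p2<n
      p<n 2F = p2<n

  anchored132-of : ∀ {σ} → ¬ Occurs (0F , 2F , 1F) σ → Anchored132 σ
  anchored132-of avoid {zero}  _   _   σ0<σz σz<σ0 = <-asym σ0<σz σz<σ0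
  anchored132-of avoid {suc y} {z} y<z z<n σ0<σz σz<σy = avoid (positions 0 (suc y) z , s≤s z≤n , y<z , z<n , σ0<σz , σz<σy)

  anchored123-of : ∀ {σ} → ¬ Occurs (0F , 1F , 2F) σ → Anchored123 σ
  anchored123-of avoid {zero}  _   _   σ0<σ0 _     = <-irrefl refl σ0<σ0
  anchored123-of avoid {suc y} {z} y<z z<n σ0<σy σy<σz = avoid (positions 0 (suc y) z , s≤s z≤n , y<z , z<n , σ0<σy , σy<σz)

  -- Rotations avoid the ascending shapes.  A rotation increases except for a single
  -- drop, where k + j passes n.

  rot-no-wrap : ∀ k j → k + j < n → rot k j ≡ k + j
  rot-no-wrap k j = %-small

  rot-wrap : ∀ {k j} → k < n → j < n → n ≤ k + j → rot k j + n ≡ k + j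
  rot-wrap {k} {j} k<n j<n n≤k+j = begin
    (k + j) % n + n         ≡⟨ cong (λ x → x % n + n) (m∸n+n≡m n≤k+j) ⟨
    (k + j ∸ n + n) % n + n ≡⟨ cong (_+ n) ([m+n]%n≡m%n (k + j ∸ n) n) ⟩
    (k + j ∸ n) % n + n     ≡⟨ cong (_+ n) (%-small (∸-<-+ (+-mono-< k<n j<n) n≤k+j)) ⟩
    k + j ∸ n + n           ≡⟨ m∸n+n≡m n≤k+j ⟩
    k + j                   ∎
    where open ≡-Reasoning

  descent : ∀ {k x y} → k < n → x < y → y < n → rot k y < rot k x → k + x < n × n ≤ k + y
  descent {k} {x} {y} k<n x<y y<n ry<rx with k + y <? n
  ... | yes k+y<n = ⊥-elim (<-asym ry<rx (subst₂ _<_ (sym (rot-no-wrap k x (<-trans (+-monoʳ-< k x<y) k+y<n)))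
                                                  (sym (rot-no-wrap k y k+y<n)) (+-monoʳ-< k x<y)))
  ... | no k+y≮n with k + x <? n
  ...   | yes k+x<n = k+x<n , ≮⇒≥ k+y≮n
  ...   | no k+x≮n = ⊥-elim (<-asym ry<rx (+-cancelʳ-< n _ _ (subst₂ _<_
                       (sym (rot-wrap k<n (<-trans x<y y<n) (≮⇒≥ k+x≮n))) (sym (rot-wrap k<n y<n (≮⇒≥ k+y≮n)))
                       (+-monoʳ-< k x<y))))

  across-drop : ∀ k x {z} → z < n → k + x < n → n ≤ k + z → rot k z < rot k x
  across-drop k x {z} z<n k+x<n n≤k+z = subst (rot k z <_) (sym (rot-no-wrap k x k+x<n)) (≤-trans (+-cancelʳ-< n (rot k z) k (begin-strict
    rot k z + n ≡⟨ rot-wrap (≤-<-trans (m≤m+n k x) k+x<n) z<n n≤k+z ⟩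
    k + z       <⟨ +-monoʳ-< k z<n ⟩
    k + n       ∎)) (m≤m+n k x))
    where open ≤-Reasoning

  -- 132 and 213 would need a value after the drop above one before it, and 321
  -- would need two drops
  rotation-avoids : ∀ {s k} → Ascending s → k < n → ¬ Occurs s (rot k)
  rotation-avoids {k = k} asc132 k<n (p , x<y , y<z , z<n , rx<rz , rz<ry) =
    let (k+y<n , n≤k+z) = descent k<n y<z z<n rz<ry
    in <-asym rx<rz (across-drop k (p 0F) z<n (<-trans (+-monoʳ-< k x<y) k+y<n) n≤k+z)
  rotation-avoids {k = k} asc213 k<n (p , x<y , y<z , z<n , ry<rx , rx<rz) =
    let (k+x<n , n≤k+y) = descent k<n x<y (<-trans y<z z<n) ry<rx
    in <-asym rx<rz (across-drop k (p 0F) z<n k+x<n (≤-trans n≤k+y (+-monoʳ-≤ k (<⇒≤ y<z))))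
  rotation-avoids asc321 k<n (p , x<y , y<z , z<n , rz<ry , ry<rx) =
    <⇒≱ (proj₁ (descent k<n y<z z<n rz<ry)) (proj₂ (descent k<n x<y (<-trans y<z z<n) ry<rx))

  complement-rotation-avoids : ∀ {a b c k} → Descending (a , b , c) → k < n → ¬ Occurs (a , b , c) (λ j → m ∸ rot k j)
  complement-rotation-avoids {k = k} d k<n occ = rotation-avoids (mirror d) k<n (occurs-complement {τ = rot k} occ)

  -- Rows of a Latin square avoiding a pattern of descending shape have cyclically
  -- ascending complements: 123 through the reflection, 231 through reversal of
  -- the columns, and 312 because its complement 132 forces rotations.

  descending-rows : ∀ {s f} → Descending s → Latin f → (∀ {i} → i < n → ¬ Occurs s (f i))
                  → ∀ {i} → i < n → Up (λ j → m ∸ f i j)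
  descending-rows {f = f} desc123 L avoid {i} i<n =
    down⇒complement-up (IsBij.bounded (Latin.row-bij L i<n))
      (reflected-rotation⇒down {f i} {f i 0} (reflected-rotation-rows L (λ i<n → anchored123-of (avoid i<n)) i<n))
  descending-rows {f = f} desc231 L avoid {i} i<n =
    down⇒complement-up (IsBij.bounded (Latin.row-bij L i<n)) (reversed-up⇒down {f i}
      (rotation⇒up {v = f i m} (rotation-rows (permute-columns m∸-bij L) anchored i<n)))
    where anchored : ∀ {i} → i < n → Anchored132 (λ j → f i (m ∸ j))
          anchored {i} i<n = anchored132-of (λ occ → avoid i<n (occurs-reverse {τ = f i} occ))
  descending-rows {f = f} desc312 L avoid {i} i<n =
    rotation⇒up {v = m ∸ f i 0} (rotation-rows (map-latin m∸-bij L) anchored i<n)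
    where anchored : ∀ {i} → i < n → Anchored132 (λ j → m ∸ f i j)
          anchored {i} i<n = anchored132-of (λ occ → avoid i<n (occurs-complement {τ = f i} occ))

  double-complement : ∀ {f} → Latin f → ∀ {i} → i < n → ∀ {j} → j < n → m ∸ (m ∸ f i j) ≡ f i j
  double-complement L i<n j<n = m∸[m∸n]≡n (s≤s⁻¹ (IsBij.bounded (Latin.row-bij L i<n) j<n))

  complement-avoids : ∀ {a b c} {f : ℕ → ℕ → ℕ} → (∀ {i} → i < n → ¬ Occurs (c , b , a) (f i))
                    → ∀ {i} → i < n → ¬ Occurs (a , b , c) (λ j → m ∸ f i j)
  complement-avoids {f = f} avoid {i} i<n occ = avoid i<n (occurs-complement {τ = f i} occ)

  -- Rows of a Latin square avoiding a pattern of ascending shape ascend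
  -- cyclically: 132 by rotation-rows, 213 and 321 as complements of 231 and 123.
  ascending-rows : ∀ {s f} → Ascending s → Latin f → (∀ {i} → i < n → ¬ Occurs s (f i))
                 → ∀ {i} → i < n → Up (f i)
  ascending-rows {f = f} asc132 L avoid {i} i<n =
    rotation⇒up {v = f i 0} (rotation-rows L (λ i<n → anchored132-of (avoid i<n)) i<n)
  ascending-rows {f = f} asc213 L avoid i<n = up-cong (double-complement L i<n)
    (descending-rows {f = λ i j → m ∸ f i j} desc231 (map-latin m∸-bij L) (complement-avoids {f = f} avoid) i<n)
  ascending-rows {f = f} asc321 L avoid i<n = up-cong (double-complement L i<n)
    (descending-rows {f = λ i j → m ∸ f i j} desc123 (map-latin m∸-bij L) (complement-avoids {f = f} avoid) i<n)

  cyclic : ℕ → ℕ → ℕ → ℕ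
  cyclic c i j = rot (rot c i) j

  cyclic-symmetric : ∀ c i j → cyclic c i j ≡ cyclic c j i
  cyclic-symmetric c i j = begin
    ((c + i) % n + j) % n ≡⟨ %-absorbˡ (c + i) j ⟩
    (c + i + j) % n       ≡⟨ cong (_% n) (trans (+-assoc c i j) (trans (cong (c +_) (+-comm i j)) (sym (+-assoc c j i)))) ⟩
    (c + j + i) % n       ≡⟨ %-absorbˡ (c + j) i ⟨
    ((c + j) % n + i) % n ∎
    where open ≡-Reasoning

  cyclic-corner : ∀ {c} → c < n → cyclic c 0 0 ≡ c
  cyclic-corner {c} c<n = trans (rot-zero (rot<n c 0)) (rot-zero c<n)
    where rot-zero : ∀ {k} → k < n → rot k 0 ≡ k
          rot-zero {k} k<n = trans (cong (_% n) (+-identityʳ k)) (%-small k<n)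

  cyclic-latin : ∀ c → Latin (cyclic c)
  cyclic-latin c = record
    { row-bij = λ {i} _ → rot-bij (rot<n c i)
    ; col-bij = λ {j} _ → bij-cong (rot-bij (rot<n c j)) (λ {i} _ → cyclic-symmetric c j i)
    }

  ascending-square : ∀ {g} → Latin g → (∀ {i} → i < n → Up (g i)) → (∀ {j} → j < n → Up (λ i → g i j))
                   → ∀ {i j} → i < n → j < n → g i j ≡ cyclic (g 0 0) i j
  ascending-square {g} L rows cols {i} {j} i<n j<n = begin
    g i j               ≡⟨ up⇒rotation (IsBij.bounded (Latin.row-bij L i<n) (s≤s z≤n)) (rows i<n) j<n ⟩
    rot (g i 0) j       ≡⟨ cong (λ x → rot x j) (up⇒rotation (IsBij.bounded (Latin.col-bij L (s≤s z≤n)) (s≤s z≤n)) (cols (s≤s z≤n)) i<n) ⟩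
    rot (rot (g 0 0) i) j ∎
    where open ≡-Reasoning

  toℕ-mod : ∀ {j} → j < n → toℕ (j mod n) ≡ j
  toℕ-mod {j} j<n = trans (toℕ-fromℕ< (m%n<n j n)) (%-small j<n)

  mod-toℕ : ∀ (i : Fin n) → toℕ i mod n ≡ i
  mod-toℕ i = toℕ-injective (toℕ-mod (toℕ<n i))

  lift : (Fin n → Fin n) → ℕ → ℕ
  lift φ j = toℕ (φ (j mod n))

  lift-toℕ : ∀ φ (i : Fin n) → lift φ (toℕ i) ≡ toℕ (φ i)
  lift-toℕ φ i = cong (λ k → toℕ (φ k)) (mod-toℕ i)

  OnceEach : (Fin n → Fin n) → Set
  OnceEach φ = ∀ s → ∃! _≡_ (λ j → φ j ≡ s)

  bij-of-onceEach : ∀ {φ} → OnceEach φ → IsBij (lift φ)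
  bij-of-onceEach {φ} once = record
    { bounded    = λ {j} _ → toℕ<n (φ (j mod n))
    ; injective  = λ {j} {k} j<n k<n eq → begin
        j                 ≡⟨ toℕ-mod j<n ⟨
        toℕ (j mod n)     ≡⟨ cong toℕ (unique (toℕ-injective eq)) ⟩
        toℕ (k mod n)     ≡⟨ toℕ-mod k<n ⟩
        k                 ∎
    ; surjective = λ {s} s<n → let (x , φx≡s , _) = once (s mod n) in
        toℕ x , toℕ<n x , trans (lift-toℕ φ x) (trans (cong toℕ φx≡s) (toℕ-mod s<n))
    }
    where
      open ≡-Reasoning
      unique : ∀ {x y} → φ x ≡ φ y → x ≡ y
      unique {x} {y} eq = let (_ , _ , only) = once (φ y) in trans (sym (only eq)) (only refl)

  onceEach-of-bij : ∀ {φ} → IsBij (lift φ) → OnceEach φ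
  onceEach-of-bij {φ} bij s =
    j mod n , toℕ-injective φj≡s ,
    λ {y} φy≡s → trans (cong (_mod n) (injective j<n (toℕ<n y) (trans φj≡s (sym (trans (lift-toℕ φ y) (cong toℕ φy≡s))))))
                       (mod-toℕ y)
    where
      open IsBij bij
      j = proj₁ (surjective (toℕ<n s))
      j<n = proj₁ (proj₂ (surjective (toℕ<n s)))
      φj≡s = proj₂ (proj₂ (surjective (toℕ<n s)))

  table : Square n → ℕ → ℕ → ℕ
  table M i j = toℕ (entry M (i mod n) (j mod n))

  latin-table : ∀ {M} → IsLatin M → Latin (table M)
  latin-table (rows , cols) = record
    { row-bij = λ {i} _ → bij-of-onceEach (rows (i mod n))
    ; col-bij = λ {j} _ → bij-of-onceEach (cols (j mod n))
    }

  isLatin-of-table : ∀ {M} → Latin (table M) → IsLatin M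
  isLatin-of-table {M} L =
    (λ i → subst (λ k → OnceEach (row M k)) (mod-toℕ i) (onceEach-of-bij (Latin.row-bij L (toℕ<n i)))) ,
    (λ j → subst (λ k → OnceEach (col M k)) (mod-toℕ j) (onceEach-of-bij (Latin.col-bij L (toℕ<n j))))

  occurs-of-contains : ∀ {φ π} → Contains φ π → Occurs (shape π) (lift φ)
  occurs-of-contains {φ} {π} (f , increasing , iso) =
    p , increasing 0F 1F (s≤s z≤n) , increasing 1F 2F (s≤s (s≤s z≤n)) , toℕ<n (f 2F) ,
    ordered (s≤s z≤n) , ordered (s≤s (s≤s z≤n))
    where
      p : Fin 3 → ℕ
      p k = toℕ (f k)
      ordered : ∀ {k l} → k F.< l → lift φ (p (π ⟨$⟩ˡ k)) < lift φ (p (π ⟨$⟩ˡ l))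
      ordered {k} {l} k<l = subst₂ _<_ (sym (lift-toℕ φ (f (π ⟨$⟩ˡ k)))) (sym (lift-toℕ φ (f (π ⟨$⟩ˡ l))))
        (Equivalence.from (iso (π ⟨$⟩ˡ k) (π ⟨$⟩ˡ l)) (subst₂ F._<_ (sym (inverseʳ π)) (sym (inverseʳ π)) k<l))

  contains-of-occurs : ∀ {φ π} → Occurs (shape π) (lift φ) → Contains φ π
  contains-of-occurs {φ} {π} (p , p0<p1 , p1<p2 , p2<n , lt₁ , lt₂) = f , increasing , λ a b → mk⇔ (to a b) (from a b)
    where
      p<n : ∀ k → p k < n
      p<n 0F = <-trans p0<p1 (<-trans p1<p2 p2<n)
      p<n 1F = <-trans p1<p2 p2<n
      p<n 2F = p2<n
      f : Fin 3 → Fin n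
      f k = p k mod n
      increasing : ∀ a b → a F.< b → f a F.< f b
      increasing a b a<b = subst₂ _<_ (sym (toℕ-mod (p<n a))) (sym (toℕ-mod (p<n b))) (increasing₃ p p0<p1 p1<p2 a<b)
      value : Fin 3 → ℕ
      value k = toℕ (φ (f k))
      from : ∀ a b → π ⟨$⟩ʳ a F.< π ⟨$⟩ʳ b → value a < value b
      from a b lt = subst₂ _<_ (cong value (inverseˡ π)) (cong value (inverseˡ π))
                      (increasing₃ (λ k → value (π ⟨$⟩ˡ k)) lt₁ lt₂ lt)
      to : ∀ a b → value a < value b → π ⟨$⟩ʳ a F.< π ⟨$⟩ʳ b
      to a b lt with FinP.<-cmp (π ⟨$⟩ʳ a) (π ⟨$⟩ʳ b)
      ... | tri< πa<πb _ _ = πa<πb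
      ... | tri≈ _ πa≡πb _ = ⊥-elim (<-irrefl (cong value a≡b) lt)
        where a≡b = trans (sym (inverseˡ π)) (trans (cong (π ⟨$⟩ˡ_) πa≡πb) (inverseˡ π))
      ... | tri> _ _ πb<πa = ⊥-elim (<-asym lt (from b a πb<πa))

  rows-avoid : ∀ {M π} → SquareAvoids M π → ∀ {i} → i < n → ¬ Occurs (shape π) (table M i)
  rows-avoid {M} {π} (avoid , _) {i} _ occ = avoid (i mod n) (contains-of-occurs {row M (i mod n)} {π} occ)

  columns-avoid : ∀ {M π} → SquareAvoids M π → ∀ {j} → j < n → ¬ Occurs (shape π) (λ i → table M i j)
  columns-avoid {M} {π} (_ , avoid) {j} _ occ = avoid (j mod n) (contains-of-occurs {col M (j mod n)} {π} occ)

  squareAvoids-of-table : ∀ {M π} → (∀ {i} → i < n → ¬ Occurs (shape π) (table M i))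
                        → (∀ {j} → j < n → ¬ Occurs (shape π) (λ i → table M i j)) → SquareAvoids M π
  squareAvoids-of-table {M} {π} rows cols =
    (λ i c → rows (toℕ<n i) (subst (λ k → Occurs (shape π) (lift (row M k))) (sym (mod-toℕ i)) (occurs-of-contains {row M i} {π} c))) ,
    (λ j c → cols (toℕ<n j) (subst (λ k → Occurs (shape π) (lift (col M k))) (sym (mod-toℕ j)) (occurs-of-contains {col M j} {π} c)))

  squareOf : (ℕ → ℕ → ℕ) → Square n
  squareOf g = tabulate λ i → tabulate λ j → g (toℕ i) (toℕ j) mod n

  table-squareOf : ∀ {g} → (∀ {i j} → i < n → j < n → g i j < n)
                 → ∀ {i j} → i < n → j < n → table (squareOf g) i j ≡ g i j
  table-squareOf {g} bounded {i} {j} i<n j<n = begin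
    toℕ (entry (squareOf g) (i mod n) (j mod n))  ≡⟨ cong toℕ (entry-squareOf (i mod n) (j mod n)) ⟩
    toℕ (g (toℕ (i mod n)) (toℕ (j mod n)) mod n) ≡⟨ cong₂ (λ a b → toℕ (g a b mod n)) (toℕ-mod i<n) (toℕ-mod j<n) ⟩
    toℕ (g i j mod n)                             ≡⟨ toℕ-mod (bounded i<n j<n) ⟩
    g i j                                         ∎
    where
      open ≡-Reasoning
      entry-squareOf : ∀ i j → entry (squareOf g) i j ≡ g (toℕ i) (toℕ j) mod n
      entry-squareOf i j = trans (cong (λ r → lookup r j) (lookup∘tabulate (λ i → tabulate λ j → g (toℕ i) (toℕ j) mod n) i))
                                 (lookup∘tabulate (λ j → g (toℕ i) (toℕ j) mod n) j)

  square-of-table : ∀ {M g} → (∀ {i j} → i < n → j < n → table M i j ≡ g i j) → M ≡ squareOf g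
  square-of-table {M} {g} eq = begin
    M                   ≡⟨ tabulate∘lookup M ⟨
    tabulate (lookup M) ≡⟨ tabulate-cong (λ i → trans (sym (tabulate∘lookup (lookup M i))) (tabulate-cong (entry≡ i))) ⟩
    squareOf g          ∎
    where
      open ≡-Reasoning
      entry≡ : ∀ i j → entry M i j ≡ g (toℕ i) (toℕ j) mod n
      entry≡ i j = toℕ-injective (begin
        toℕ (entry M i j)             ≡⟨ cong₂ (λ a b → toℕ (entry M a b)) (mod-toℕ i) (mod-toℕ j) ⟨
        table M (toℕ i) (toℕ j)       ≡⟨ eq (toℕ<n i) (toℕ<n j) ⟩
        g (toℕ i) (toℕ j)             ≡⟨ toℕ-mod (subst (_< n) (eq (toℕ<n i) (toℕ<n j)) (toℕ<n _)) ⟨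
        toℕ (g (toℕ i) (toℕ j) mod n) ∎)

  cyclic-square cocyclic-square : Fin n → Square n
  cyclic-square c   = squareOf (cyclic (toℕ c))
  cocyclic-square c = squareOf (λ i j → m ∸ cyclic (toℕ c) i j)

  table-cyclic : ∀ c {i j} → i < n → j < n → table (cyclic-square c) i j ≡ cyclic (toℕ c) i j
  table-cyclic c = table-squareOf (λ {i} {j} _ _ → rot<n (rot (toℕ c) i) j)

  table-cocyclic : ∀ c {i j} → i < n → j < n → table (cocyclic-square c) i j ≡ m ∸ cyclic (toℕ c) i j
  table-cocyclic c = table-squareOf (λ {i} {j} _ _ → m∸<n (cyclic (toℕ c) i j))

  corner : Square n → ℕ
  corner M = table M 0 0

  corner-cyclic : ∀ c → corner (cyclic-square c) ≡ toℕ c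
  corner-cyclic c = trans (table-cyclic c (s≤s z≤n) (s≤s z≤n)) (cyclic-corner (toℕ<n c))

  corner-cocyclic : ∀ c → corner (cocyclic-square c) ≡ m ∸ toℕ c
  corner-cocyclic c = trans (table-cocyclic c (s≤s z≤n) (s≤s z≤n)) (cong (m ∸_) (cyclic-corner (toℕ<n c)))

  ascending-count : ∀ {π} → Ascending (shape π) → LCount n π n
  ascending-count {π} a = card-of-family cyclic-square injective good complete
    where
      injective : ∀ {c d} → cyclic-square c ≡ cyclic-square d → c ≡ d
      injective {c} {d} eq = toℕ-injective (trans (sym (corner-cyclic c)) (trans (cong corner eq) (corner-cyclic d)))
      good : ∀ c → IsLatin (cyclic-square c) × SquareAvoids (cyclic-square c) π
      good c = isLatin-of-table {cyclic-square c}
                 (latin-cong (cyclic-latin (toℕ c)) (λ i<n j<n → sym (table-cyclic c i<n j<n))) ,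
               squareAvoids-of-table {cyclic-square c} {π}
                 (λ {i} i<n occ → rotation-avoids a (rot<n (toℕ c) i) (occurs-cong (table-cyclic c i<n) occ))
                 (λ {j} j<n occ → rotation-avoids a (rot<n (toℕ c) j)
                    (occurs-cong (λ {i} i<n → trans (table-cyclic c i<n j<n) (cyclic-symmetric (toℕ c) i j)) occ))
      complete : ∀ M → IsLatin M × SquareAvoids M π → ∃ λ c → M ≡ cyclic-square c
      complete M (latin , avoid) =
        entry M 0F 0F ,
        square-of-table (ascending-square L (ascending-rows a L (rows-avoid {M} {π} avoid))
                                            (ascending-rows a (transpose-latin L) (columns-avoid {M} {π} avoid)))
        where L = latin-table {M} latin

  descending-count : ∀ {π} → Descending (shape π) → LCount n π n
  descending-count {π} d = card-of-family cocyclic-square injective good complete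
    where
      injective : ∀ {c d} → cocyclic-square c ≡ cocyclic-square d → c ≡ d
      injective {c} {d} eq = toℕ-injective (IsBij.injective m∸-bij (toℕ<n c) (toℕ<n d)
        (trans (sym (corner-cocyclic c)) (trans (cong corner eq) (corner-cocyclic d))))
      good : ∀ c → IsLatin (cocyclic-square c) × SquareAvoids (cocyclic-square c) π
      good c = isLatin-of-table {cocyclic-square c}
                 (latin-cong (map-latin m∸-bij (cyclic-latin (toℕ c))) (λ i<n j<n → sym (table-cocyclic c i<n j<n))) ,
               squareAvoids-of-table {cocyclic-square c} {π}
                 (λ {i} i<n occ → complement-rotation-avoids d (rot<n (toℕ c) i) (occurs-cong (table-cocyclic c i<n) occ))
                 (λ {j} j<n occ → complement-rotation-avoids d (rot<n (toℕ c) j)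
                    (occurs-cong (λ {i} i<n → trans (table-cocyclic c i<n j<n) (cong (m ∸_) (cyclic-symmetric (toℕ c) i j))) occ))
      complete : ∀ M → IsLatin M × SquareAvoids M π → ∃ λ c → M ≡ cocyclic-square c
      complete M (latin , avoid) = opposite (entry M 0F 0F) , square-of-table complement-cyclic
        where
          L = latin-table {M} latin
          ascending : ∀ {i j} → i < n → j < n → m ∸ table M i j ≡ cyclic (m ∸ corner M) i j
          ascending = ascending-square (map-latin m∸-bij L) (descending-rows d L (rows-avoid {M} {π} avoid))
                                       (descending-rows d (transpose-latin L) (columns-avoid {M} {π} avoid))
          complement-cyclic : ∀ {i j} → i < n → j < n → table M i j ≡ m ∸ cyclic (toℕ (opposite (entry M 0F 0F))) i j
          complement-cyclic {i} {j} i<n j<n = trans (sym (double-complement L i<n j<n))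
            (cong (m ∸_) (trans (ascending i<n j<n) (cong (λ c → cyclic c i j) (sym (opposite-prop (entry M 0F 0F))))))

theorem2 : (n : ℕ) → 1 ≤ n → (π : Permutation′ 3) → LCount n π n
theorem2 (suc m) _ π with classify (π ⟨$⟩ˡ_) (inverse-injective π)
... | inj₁ ascending  = Order.ascending-count m {π} ascending
... | inj₂ descending = Order.descending-count m {π} descending
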